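{- For integers $n\ge 1$, $s\ge 0$, and $0\le r\le 2n$, let $a(n,s,r)$ be the number of binary sequences $(b_1,\dots,b_{(s+2)n+1})$ of length $(s+2)n+1$ such that (i) for every $j\ge 1$, if the sequence contains at least $j$ occurrences of the pattern $10$ (i.e. indices $p$ with $b_p=1$, $b_{p+1}=0$), then the $j$th such occurrence (in left-to-right order) occupies positions $p,p+1$ with $p\ge (s+2)j+1$; and (ii) the total number of occurrences of $10$ and of $01$ (i.e. the number of indices $i$ with $b_i\ne b_{i+1}$) is at most $r$. Then \[ a(n,s,r) = 2\binom{(s+2)n-1}{r} - (s-2) \sum_{i=0}^{r-1} \binom{(s+2)n-1 }{i}. \] -}

module Defs where

open import Data.Bool using (Bool; true; false)
open import Data.Nat using (ℕ; zero; suc; _+_; _*_; _≤_; _≤?_)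
open import Data.List using (List; []; _∷_; length; lookup; filter; map; _++_)
open import Data.Vec using (Vec; []; _∷_; toList)
open import Data.Fin using (Fin; toℕ)
open import Data.Fin.Properties using (all?)
open import Relation.Nullary using (Dec)
open import Relation.Nullary.Decidable using (_×-dec_)
open import Data.Product using (_×_)

-- Positions p (1-indexed, left to right) of the occurrences of the pattern 10,
-- i.e. b_p = 1 and b_{p+1} = 0.  `idx` is the index of the head element.
tenPositionsFrom : ℕ → List Bool → List ℕ
tenPositionsFrom idx []                    = []
tenPositionsFrom idx (b ∷ [])              = []
tenPositionsFrom idx (true ∷ false ∷ bs)   = idx ∷ tenPositionsFrom (suc idx) (false ∷ bs)
tenPositionsFrom idx (b ∷ b′ ∷ bs)         = tenPositionsFrom (suc idx) (b′ ∷ bs)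

tenPositions : List Bool → List ℕ
tenPositions = tenPositionsFrom 1

changes : List Bool → ℕ
changes []                  = 0
changes (b ∷ [])            = 0
changes (true ∷ false ∷ bs) = suc (changes (false ∷ bs))
changes (false ∷ true ∷ bs) = suc (changes (true ∷ bs))
changes (b ∷ b′ ∷ bs)       = changes (b′ ∷ bs)

-- Condition (i): for every j ≥ 1 such that there are at least j occurrences of 10,
-- the j-th occurrence (at positions p, p+1) has p ≥ (s+2) j + 1.
-- (The j-th occurrence is entry k = j-1 of tenPositions.)
Cond1 : ℕ → List Bool → Set
Cond1 s bs = (k : Fin (length (tenPositions bs))) →
  (s + 2) * suc (toℕ k) + 1 ≤ lookup (tenPositions bs) k

Cond2 : ℕ → List Bool → Set
Cond2 r bs = changes bs ≤ r

Good : ℕ → ℕ → List Bool → Set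
Good s r bs = Cond1 s bs × Cond2 r bs

good? : ∀ s r bs → Dec (Good s r bs)
good? s r bs = all? (λ k → (s + 2) * suc (toℕ k) + 1 ≤? lookup (tenPositions bs) k)
               ×-dec (changes bs ≤? r)

allBinary : (m : ℕ) → List (Vec Bool m)
allBinary zero    = [] ∷ []
allBinary (suc m) = map (true ∷_) (allBinary m) ++ map (false ∷_) (allBinary m)

a : ℕ → ℕ → ℕ → ℕ
a n s r = length (filter (λ v → good? s r (toList v)) (allBinary ((s + 2) * n + 1)))

module Submission where

-- Write a sequence as its first bit f followed by its change sequence d ∈ {0,1}^N, N = (s+2)n, where
-- d_i = 1 iff b_i ≠ b_{i+1}. Condition (ii) says that d has weight c ≤ r, and since the j-th occurrence
-- of 10 is the (2j − f)-th change, condition (i) becomes the ballot condition: f plus the number of ones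
-- among the first (s+2)j letters of d is less than 2j, for j = 1, …, n.
-- Fix d of weight c ≤ 2n and let Z t = 2t − (number of ones among the first (s+2)t letters of dd). This
-- walk rises by at most 2 per step and gains 2n − c per period n. The pair (f, d rotated by (s+2)i) is a
-- ballot pair iff Z stays at least f + 1 above Z i for the next n steps, and a telescoping argument with
-- the running minima of Z shows that this happens for exactly 2n − c of the 2n pairs (f, i). Averaging
-- over rotations, n times the number of ballot pairs with |d| = c is (2n − c) C(N, c), which by Pascal's
-- rule and absorption is n (2 C(N−1, c) − s C(N−1, c−1)); summing over c ≤ r gives the formula.

open import Defs

module Sums where

  open import Data.Nat
  open import Data.Nat.Properties
  open import Data.List using ([]; _∷_; _∷ʳ_; map; upTo)
  open import Function using (_∘_; _⇔_; Equivalence)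
  open import Data.Sum using ([_,_]′)
  open import Data.List.Properties using (upTo-∷ʳ; map-++)
  open import Data.Nat.ListAction using (sum)
  open import Data.Nat.ListAction.Properties using (sum-++)
  open import Data.Empty using (⊥-elim)
  open import Relation.Nullary using (Dec; yes; no; ¬_)
  open import Relation.Nullary.Decidable using (_×-dec_)
  open import Relation.Binary.PropositionalEquality

  𝟙[_] : {P : Set} → Dec P → ℕ
  𝟙[ yes _ ] = 1
  𝟙[ no  _ ] = 0

  𝟙-yes : {P : Set} (p : Dec P) → P → 𝟙[ p ] ≡ 1
  𝟙-yes (yes _) _  = refl
  𝟙-yes (no ¬x) x  = ⊥-elim (¬x x)

  𝟙-no : {P : Set} (p : Dec P) → ¬ P → 𝟙[ p ] ≡ 0
  𝟙-no (yes x) ¬x = ⊥-elim (¬x x)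
  𝟙-no (no _)  _  = refl

  𝟙-cong : {P Q : Set} (p : Dec P) (q : Dec Q) → P ⇔ Q → 𝟙[ p ] ≡ 𝟙[ q ]
  𝟙-cong (yes x) q       P⇔Q = sym (𝟙-yes q (Equivalence.to P⇔Q x))
  𝟙-cong (no ¬x) (yes y) P⇔Q = ⊥-elim (¬x (Equivalence.from P⇔Q y))
  𝟙-cong (no _)  (no _)  P⇔Q = refl

  𝟙-× : {P Q : Set} (p : Dec P) (q : Dec Q) → 𝟙[ p ×-dec q ] ≡ 𝟙[ p ] * 𝟙[ q ]
  𝟙-× (yes _) (yes _) = refl
  𝟙-× (yes _) (no _)  = refl
  𝟙-× (no _)  _       = refl

  ∀<? : ∀ n {P : ℕ → Set} → (∀ j → Dec (P j)) → Dec (∀ j → j < n → P j)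
  ∀<? zero    P? = yes λ _ ()
  ∀<? (suc n) P? with ∀<? n P? | P? n
  ... | no ¬all | _      = no λ all → ¬all λ j j<n → all j (m<n⇒m<1+n j<n)
  ... | yes _   | no ¬Pn = no λ all → ¬Pn (all n ≤-refl)
  ... | yes all | yes Pn = yes λ j j<1+n → [ all j , (λ { refl → Pn }) ]′ (m<1+n⇒m<n∨m≡n j<1+n)

  ∑< : ℕ → (ℕ → ℕ) → ℕ
  ∑< zero    f = 0
  ∑< (suc n) f = ∑< n f + f n

  syntax ∑< n (λ i → e) = ∑[ i < n ] e

  ∑-cong : ∀ n {f g : ℕ → ℕ} → (∀ i → i < n → f i ≡ g i) → ∑< n f ≡ ∑< n g
  ∑-cong zero    eq = refl
  ∑-cong (suc n) eq = cong₂ _+_ (∑-cong n (λ i i<n → eq i (m<n⇒m<1+n i<n))) (eq n ≤-refl)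

  ∑-*ˡ : ∀ n x (f : ℕ → ℕ) → ∑[ i < n ] (x * f i) ≡ x * ∑< n f
  ∑-*ˡ zero    x f = sym (*-zeroʳ x)
  ∑-*ˡ (suc n) x f = trans (cong (_+ x * f n) (∑-*ˡ n x f)) (sym (*-distribˡ-+ x (∑< n f) (f n)))

  ∑-*ʳ : ∀ n x (f : ℕ → ℕ) → ∑[ i < n ] (f i * x) ≡ ∑< n f * x
  ∑-*ʳ zero    x f = refl
  ∑-*ʳ (suc n) x f = trans (cong (_+ f n * x) (∑-*ʳ n x f)) (sym (*-distribʳ-+ x (∑< n f) (f n)))

  ∑-const : ∀ n x → ∑[ i < n ] x ≡ n * x
  ∑-const zero    x = refl
  ∑-const (suc n) x = trans (cong (_+ x) (∑-const n x)) (+-comm (n * x) x)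

  ∑≡sum-upTo : ∀ n (f : ℕ → ℕ) → ∑< n f ≡ sum (map f (upTo n))
  ∑≡sum-upTo zero    f = refl
  ∑≡sum-upTo (suc n) f = begin
    ∑< n f + f n                      ≡⟨ cong₂ _+_ (∑≡sum-upTo n f) (sym (+-identityʳ (f n))) ⟩
    sum (map f (upTo n)) + (f n + 0)  ≡⟨ sym (sum-++ (map f (upTo n)) (f n ∷ [])) ⟩
    sum (map f (upTo n) ∷ʳ f n)       ≡⟨ cong sum (sym (map-++ f (upTo n) (n ∷ []))) ⟩
    sum (map f (upTo n ∷ʳ n))         ≡⟨ cong (sum ∘ map f) (upTo-∷ʳ n) ⟩
    sum (map f (upTo (suc n)))        ∎
    where open ≡-Reasoning

  𝟙[<]≡∑𝟙[≡] : ∀ w n → 𝟙[ w <? n ] ≡ ∑[ c < n ] 𝟙[ w ≟ c ]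
  𝟙[<]≡∑𝟙[≡] w zero    = 𝟙-no (w <? 0) λ ()
  𝟙[<]≡∑𝟙[≡] w (suc n) = trans (split (<-cmp w n)) (cong (_+ 𝟙[ w ≟ n ]) (𝟙[<]≡∑𝟙[≡] w n))
    where
    open import Relation.Binary.Definitions using (Tri; tri<; tri≈; tri>)
    split : Tri (w < n) (w ≡ n) (w > n) → 𝟙[ w <? suc n ] ≡ 𝟙[ w <? n ] + 𝟙[ w ≟ n ]
    split (tri< w<n w≢n _)
      rewrite 𝟙-yes (w <? suc n) (m<n⇒m<1+n w<n) | 𝟙-yes (w <? n) w<n | 𝟙-no (w ≟ n) w≢n = refl
    split (tri≈ w≮n w≡n _)
      rewrite 𝟙-yes (w <? suc n) (≤-reflexive (cong suc w≡n)) | 𝟙-no (w <? n) w≮n | 𝟙-yes (w ≟ n) w≡n = refl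
    split (tri> w≮n w≢n n<w)
      rewrite 𝟙-no (w <? suc n) (<⇒≱ n<w ∘ s≤s⁻¹) | 𝟙-no (w <? n) w≮n | 𝟙-no (w ≟ n) w≢n = refl

module BitStrings where

  open import Data.Bool using (Bool; true; false; _xor_)
  open import Data.Nat
  open import Data.Nat.Combinatorics using (_C_; nCk+nC[k+1]≡[n+1]C[k+1])
  open import Data.Nat.Properties
  open import Data.List using (List; []; _∷_; _++_; _∷ʳ_; [_]; length; take; drop; filter; map)
  import Data.Vec as Vec
  open import Data.Vec using (toList)
  open import Relation.Nullary using (Dec; yes; no; does)
  open import Data.List.Properties using (length-++; filter-++; ++-assoc; ++-identityʳ; length-take; take-take; take++drop≡id)
  open import Relation.Binary.PropositionalEquality hiding ([_])
  open import Algebra.Properties.CommutativeSemigroup +-commutativeSemigroup using (interchange)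
  open import Function using (mk⇔)
  open Sums

  bit : Bool → ℕ
  bit true  = 1
  bit false = 0

  weight : List Bool → ℕ
  weight []       = 0
  weight (b ∷ bs) = bit b + weight bs

  weight-++ : ∀ xs ys → weight (xs ++ ys) ≡ weight xs + weight ys
  weight-++ []       ys = refl
  weight-++ (b ∷ xs) ys = trans (cong (bit b +_) (weight-++ xs ys)) (sym (+-assoc (bit b) (weight xs) (weight ys)))

  weight-take-mono : ∀ {a b} xs → a ≤ b → weight (take a xs) ≤ weight (take b xs)
  weight-take-mono                     xs       z≤n       = z≤n
  weight-take-mono {suc a} {suc b}     []       (s≤s a≤b) = z≤n
  weight-take-mono {suc a} {suc b}     (x ∷ xs) (s≤s a≤b) = +-monoʳ-≤ (bit x) (weight-take-mono xs a≤b)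

  rotate : {A : Set} → ℕ → List A → List A
  rotate zero    xs       = xs
  rotate (suc k) []       = []
  rotate (suc k) (x ∷ xs) = rotate k (xs ∷ʳ x)

  weight-rotate : ∀ k xs → weight (rotate k xs) ≡ weight xs
  weight-rotate zero    xs       = refl
  weight-rotate (suc k) []       = refl
  weight-rotate (suc k) (x ∷ xs) = begin
    weight (rotate k (xs ∷ʳ x)) ≡⟨ weight-rotate k (xs ∷ʳ x) ⟩
    weight (xs ∷ʳ x)            ≡⟨ weight-++ xs [ x ] ⟩
    weight xs + (bit x + 0)     ≡⟨ +-comm (weight xs) (bit x + 0) ⟩
    bit x + 0 + weight xs       ≡⟨ cong (_+ weight xs) (+-identityʳ (bit x)) ⟩
    bit x + weight xs           ∎
    where open ≡-Reasoning

  rotate≡drop++take : {A : Set} (k : ℕ) (xs : List A) → k ≤ length xs → rotate k xs ≡ drop k xs ++ take k xs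
  rotate≡drop++take zero    xs       _         = sym (++-identityʳ xs)
  rotate≡drop++take (suc k) (x ∷ xs) (s≤s k≤n) = begin
    rotate k (xs ∷ʳ x)                      ≡⟨ rotate≡drop++take k (xs ∷ʳ x) k≤n+1 ⟩
    drop k (xs ∷ʳ x) ++ take k (xs ∷ʳ x)    ≡⟨ cong₂ _++_ (drop-∷ʳ k xs k≤n) (take-∷ʳ k xs k≤n) ⟩
    (drop k xs ∷ʳ x) ++ take k xs           ≡⟨ ++-assoc (drop k xs) [ x ] (take k xs) ⟩
    drop k xs ++ x ∷ take k xs              ∎
    where
    open ≡-Reasoning
    k≤n+1 : k ≤ length (xs ∷ʳ x)
    k≤n+1 = ≤-trans (m≤n⇒m≤1+n k≤n) (≤-reflexive (sym (trans (length-++ xs) (+-comm (length xs) 1))))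
    drop-∷ʳ : ∀ k ys → k ≤ length ys → drop k (ys ∷ʳ x) ≡ drop k ys ∷ʳ x
    drop-∷ʳ zero    ys       _         = refl
    drop-∷ʳ (suc k) (y ∷ ys) (s≤s k≤n) = drop-∷ʳ k ys k≤n
    take-∷ʳ : ∀ k ys → k ≤ length ys → take k (ys ∷ʳ x) ≡ take k ys
    take-∷ʳ zero    ys       _         = refl
    take-∷ʳ (suc k) (y ∷ ys) (s≤s k≤n) = cong (y ∷_) (take-∷ʳ k ys k≤n)

  module _ {A : Set} where

    take-length-++ : ∀ (xs : List A) ys k → take (length xs + k) (xs ++ ys) ≡ xs ++ take k ys
    take-length-++ []       ys k = refl
    take-length-++ (x ∷ xs) ys k = cong (x ∷_) (take-length-++ xs ys k)

    take-++-≤ : ∀ (xs : List A) ys k → k ≤ length xs → take k (xs ++ ys) ≡ take k xs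
    take-++-≤ xs       ys zero    _         = refl
    take-++-≤ (x ∷ xs) ys (suc k) (s≤s k≤n) = cong (x ∷_) (take-++-≤ xs ys k k≤n)

    take-++-cong : ∀ (xs : List A) {ys zs} k → take (k ∸ length xs) ys ≡ take (k ∸ length xs) zs →
                   take k (xs ++ ys) ≡ take k (xs ++ zs)
    take-++-cong []       k       eq = eq
    take-++-cong (x ∷ xs) zero    eq = refl
    take-++-cong (x ∷ xs) (suc k) eq = cong (x ∷_) (take-++-cong xs k eq)

  weight-take-rotate : ∀ d a b → a ≤ length d → b ≤ length d →
                       weight (take b (rotate a d)) + weight (take a d) ≡ weight (take (a + b) (d ++ d))
  weight-take-rotate d a b a≤n b≤n = begin
    weight (take b (rotate a d)) + weight (take a d)      ≡⟨ +-comm (weight (take b (rotate a d))) _ ⟩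
    weight (take a d) + weight (take b (rotate a d))      ≡⟨ sym (weight-++ (take a d) _) ⟩
    weight (take a d ++ take b (rotate a d))              ≡⟨ cong weight (sym (take-length-++ (take a d) _ b)) ⟩
    weight (take (length (take a d) + b) (take a d ++ rotate a d))
      ≡⟨ cong₂ (λ k xs → weight (take (k + b) xs)) (trans (length-take a d) (m≤n⇒m⊓n≡m a≤n)) d++prefix ⟩
    weight (take (a + b) (d ++ take a d))
      ≡⟨ cong weight (take-++-cong d (a + b) (trans (take-take _ a d) (cong (λ k → take k d) (m≤n⇒m⊓n≡m excess≤a)))) ⟩
    weight (take (a + b) (d ++ d))                        ∎
    where
    open ≡-Reasoning
    d++prefix : take a d ++ rotate a d ≡ d ++ take a d
    d++prefix = begin
      take a d ++ rotate a d               ≡⟨ cong (take a d ++_) (rotate≡drop++take a d a≤n) ⟩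
      take a d ++ (drop a d ++ take a d)   ≡⟨ sym (++-assoc (take a d) (drop a d) (take a d)) ⟩
      (take a d ++ drop a d) ++ take a d   ≡⟨ cong (_++ take a d) (take++drop≡id a d) ⟩
      d ++ take a d                        ∎
    excess≤a : a + b ∸ length d ≤ a
    excess≤a = ≤-trans (∸-monoˡ-≤ (length d) (+-monoʳ-≤ a b≤n)) (≤-reflexive (m+n∸n≡m a (length d)))

  applyChanges : Bool → List Bool → List Bool
  applyChanges f []      = []
  applyChanges f (x ∷ d) = (f xor x) ∷ applyChanges (f xor x) d

  changes-applyChanges : ∀ f d → changes (f ∷ applyChanges f d) ≡ weight d
  changes-applyChanges f     []          = refl
  changes-applyChanges true  (true  ∷ d) = cong suc (changes-applyChanges false d)
  changes-applyChanges true  (false ∷ d) = changes-applyChanges true d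
  changes-applyChanges false (true  ∷ d) = cong suc (changes-applyChanges true d)
  changes-applyChanges false (false ∷ d) = changes-applyChanges false d

  sumBits : ℕ → (List Bool → ℕ) → ℕ
  sumBits zero    h = h []
  sumBits (suc n) h = sumBits n (λ v → h (true ∷ v)) + sumBits n (λ v → h (false ∷ v))

  sumBits-cong : ∀ n {h g : List Bool → ℕ} → (∀ v → length v ≡ n → h v ≡ g v) → sumBits n h ≡ sumBits n g
  sumBits-cong zero    eq = eq [] refl
  sumBits-cong (suc n) eq = cong₂ _+_ (sumBits-cong n (λ v e → eq (true ∷ v) (cong suc e)))
                                      (sumBits-cong n (λ v e → eq (false ∷ v) (cong suc e)))

  sumBits-+ : ∀ n (h g : List Bool → ℕ) → sumBits n (λ v → h v + g v) ≡ sumBits n h + sumBits n g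
  sumBits-+ zero    h g = refl
  sumBits-+ (suc n) h g = trans (cong₂ _+_ (sumBits-+ n (λ v → h (true ∷ v)) (λ v → g (true ∷ v)))
                                            (sumBits-+ n (λ v → h (false ∷ v)) (λ v → g (false ∷ v))))
                                (interchange (sumBits n (λ v → h (true ∷ v))) (sumBits n (λ v → g (true ∷ v)))
                                             (sumBits n (λ v → h (false ∷ v))) (sumBits n (λ v → g (false ∷ v))))

  sumBits-*ˡ : ∀ n x (h : List Bool → ℕ) → sumBits n (λ v → x * h v) ≡ x * sumBits n h
  sumBits-*ˡ zero    x h = refl
  sumBits-*ˡ (suc n) x h = trans (cong₂ _+_ (sumBits-*ˡ n x _) (sumBits-*ˡ n x _)) (sym (*-distribˡ-+ x _ _))

  sumBits-zero : ∀ n → sumBits n (λ _ → 0) ≡ 0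
  sumBits-zero zero    = refl
  sumBits-zero (suc n) = cong₂ _+_ (sumBits-zero n) (sumBits-zero n)

  sumBits-∑ : ∀ n k (h : ℕ → List Bool → ℕ) → sumBits n (λ v → ∑[ i < k ] h i v) ≡ ∑[ i < k ] sumBits n (h i)
  sumBits-∑ n zero    h = sumBits-zero n
  sumBits-∑ n (suc k) h = trans (sumBits-+ n (λ v → ∑[ i < k ] h i v) (h k)) (cong (_+ sumBits n (h k)) (sumBits-∑ n k h))

  sumBits-∷ʳ : ∀ n (h : List Bool → ℕ) →
               sumBits (suc n) h ≡ sumBits n (λ v → h (v ∷ʳ true)) + sumBits n (λ v → h (v ∷ʳ false))
  sumBits-∷ʳ zero    h = refl
  sumBits-∷ʳ (suc n) h = trans (cong₂ _+_ (sumBits-∷ʳ n (λ v → h (true ∷ v))) (sumBits-∷ʳ n (λ v → h (false ∷ v))))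
    (interchange (sumBits n (λ v → h (true ∷ v ∷ʳ true)))  (sumBits n (λ v → h (true ∷ v ∷ʳ false)))
                 (sumBits n (λ v → h (false ∷ v ∷ʳ true))) (sumBits n (λ v → h (false ∷ v ∷ʳ false))))

  sumBits-rotate : ∀ k n (h : List Bool → ℕ) → sumBits n (λ v → h (rotate k v)) ≡ sumBits n h
  sumBits-rotate zero    n       h = refl
  sumBits-rotate (suc k) zero    h = refl
  sumBits-rotate (suc k) (suc n) h = trans (sym (sumBits-∷ʳ n (λ v → h (rotate k v)))) (sumBits-rotate k (suc n) h)

  sumBits-applyChanges : ∀ n f (h : List Bool → ℕ) → sumBits n (λ d → h (applyChanges f d)) ≡ sumBits n h
  sumBits-applyChanges zero    f     h = refl
  sumBits-applyChanges (suc n) true  h = trans (cong₂ _+_ (sumBits-applyChanges n false (λ v → h (false ∷ v)))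
                                                          (sumBits-applyChanges n true (λ v → h (true ∷ v))))
                                               (+-comm (sumBits n (λ v → h (false ∷ v))) (sumBits n (λ v → h (true ∷ v))))
  sumBits-applyChanges (suc n) false h = cong₂ _+_ (sumBits-applyChanges n true (λ v → h (true ∷ v)))
                                                   (sumBits-applyChanges n false (λ v → h (false ∷ v)))

  length-filter-allBinary : ∀ n {P : List Bool → Set} (P? : ∀ b → Dec (P b)) →
    length (filter (λ v → P? (toList v)) (allBinary n)) ≡ sumBits n (λ b → 𝟙[ P? b ])
  length-filter-allBinary zero    P? with P? []
  ... | yes _ = refl
  ... | no  _ = refl
  length-filter-allBinary (suc n) {P} P? = begin
    length (filter Q? (map (true Vec.∷_) (allBinary n) ++ map (false Vec.∷_) (allBinary n)))
      ≡⟨ cong length (filter-++ Q? (map (true Vec.∷_) (allBinary n)) _) ⟩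
    length (filter Q? (map (true Vec.∷_) (allBinary n)) ++ filter Q? (map (false Vec.∷_) (allBinary n)))
      ≡⟨ length-++ (filter Q? (map (true Vec.∷_) (allBinary n))) ⟩
    length (filter Q? (map (true Vec.∷_) (allBinary n))) + length (filter Q? (map (false Vec.∷_) (allBinary n)))
      ≡⟨ cong₂ _+_ (trans (length-filter-map Q? (true Vec.∷_) (allBinary n))
                          (length-filter-allBinary n (λ b → P? (true ∷ b))))
                   (trans (length-filter-map Q? (false Vec.∷_) (allBinary n))
                          (length-filter-allBinary n (λ b → P? (false ∷ b)))) ⟩
    sumBits (suc n) (λ b → 𝟙[ P? b ]) ∎
    where
    open ≡-Reasoning
    Q? : ∀ {k} (v : Vec.Vec Bool k) → Dec (P (toList v))
    Q? v = P? (toList v)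
    length-filter-map : ∀ {A B : Set} {R : B → Set} (R? : ∀ b → Dec (R b)) (f : A → B) xs →
                        length (filter R? (map f xs)) ≡ length (filter (λ x → R? (f x)) xs)
    length-filter-map R? f []       = refl
    length-filter-map R? f (x ∷ xs) with does (R? (f x))
    ... | true  = cong suc (length-filter-map R? f xs)
    ... | false = length-filter-map R? f xs

  sumBits-weight≡C : ∀ n c → sumBits n (λ v → 𝟙[ weight v ≟ c ]) ≡ n C c
  sumBits-weight≡C zero    zero    = refl
  sumBits-weight≡C zero    (suc c) = refl
  sumBits-weight≡C (suc n) zero    = begin
    sumBits n (λ v → 𝟙[ suc (weight v) ≟ 0 ]) + sumBits n (λ v → 𝟙[ weight v ≟ 0 ])
      ≡⟨ cong₂ _+_ (sumBits-zero n) (sumBits-weight≡C n 0) ⟩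
    1 ∎
    where open ≡-Reasoning
  sumBits-weight≡C (suc n) (suc c) = begin
    sumBits n (λ v → 𝟙[ suc (weight v) ≟ suc c ]) + sumBits n (λ v → 𝟙[ weight v ≟ suc c ])
      ≡⟨ cong (_+ sumBits n (λ v → 𝟙[ weight v ≟ suc c ])) (sumBits-cong n λ v _ →
           𝟙-cong (suc (weight v) ≟ suc c) (weight v ≟ c) (mk⇔ suc-injective (cong suc))) ⟩
    sumBits n (λ v → 𝟙[ weight v ≟ c ]) + sumBits n (λ v → 𝟙[ weight v ≟ suc c ])
      ≡⟨ cong₂ _+_ (sumBits-weight≡C n c) (sumBits-weight≡C n (suc c)) ⟩
    n C c + n C suc c
      ≡⟨ nCk+nC[k+1]≡[n+1]C[k+1] n c ⟩
    suc n C suc c ∎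
    where open ≡-Reasoning

module TenPositions where

  open import Data.Bool using (Bool; true; false)
  open import Data.Nat
  open import Data.Nat.Properties
  open import Data.Fin using (Fin; toℕ) renaming (zero to fzero; suc to fsuc)
  open import Data.List using (List; []; _∷_; length; take; lookup)
  open import Data.List.Properties using (take-all)
  open import Data.Product using (_×_; _,_; ∃-syntax)
  open import Relation.Nullary using (Dec; ¬_; yes; no; contradiction)
  open import Relation.Nullary.Decidable using (decidable-stable)
  open import Relation.Binary.PropositionalEquality
  open Sums using (∀<?; 𝟙[_])
  open BitStrings

  tens : ℕ → Bool → List Bool → List ℕ
  tens idx f d = tenPositionsFrom idx (f ∷ applyChanges f d)

  private
    suc+suc : ∀ a → suc a + suc a ≡ 2 + (a + a)
    suc+suc a = cong suc (+-suc a a)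

    suc+suc≰bit : ∀ k f → ¬ suc k + suc k ≤ bit f + 0
    suc+suc≰bit k true  (s≤s k+1+k≤0) = m+1+n≢0 k (n≤0⇒n≡0 k+1+k≤0)
    suc+suc≰bit k false ()

    <-shift : ∀ {x} idx t → x < suc idx + t → x < idx + suc t
    <-shift {x} idx t = subst (x <_) (sym (+-suc idx t))

  lookup-tens : ∀ idx f d (k : Fin (length (tens idx f d))) →
    ∃[ p ] lookup (tens idx f d) k ≡ idx + p × suc (toℕ k) + suc (toℕ k) ≤ bit f + weight (take (suc p) d)
  lookup-tens idx true  (true  ∷ d) fzero    = 0 , sym (+-identityʳ idx) , ≤-refl
  lookup-tens idx true  (true  ∷ d) (fsuc k) with lookup-tens (suc idx) false d k
  ... | p , eq , reached = suc p , trans eq (sym (+-suc idx p)) ,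
                           subst (_≤ 2 + weight (take (suc p) d)) (sym (suc+suc (suc (toℕ k)))) (s≤s (s≤s reached))
  lookup-tens idx true  (false ∷ d) k with lookup-tens (suc idx) true d k
  ... | p , eq , reached = suc p , trans eq (sym (+-suc idx p)) , reached
  lookup-tens idx false (true  ∷ d) k with lookup-tens (suc idx) true d k
  ... | p , eq , reached = suc p , trans eq (sym (+-suc idx p)) , reached
  lookup-tens idx false (false ∷ d) k with lookup-tens (suc idx) false d k
  ... | p , eq , reached = suc p , trans eq (sym (+-suc idx p)) , reached

  tens-reach : ∀ idx f d t k → suc k + suc k ≤ bit f + weight (take t d) →
    ∃[ i ] toℕ i ≡ k × lookup (tens idx f d) i < idx + t
  tens-reach idx f     d           zero    k       reached = contradiction reached (suc+suc≰bit k f)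
  tens-reach idx f     []          (suc t) k       reached = contradiction reached (suc+suc≰bit k f)
  tens-reach idx true  (true  ∷ d) (suc t) zero    _       = fzero , refl , m<m+n idx z<s
  tens-reach idx true  (true  ∷ d) (suc t) (suc k) reached
    with tens-reach (suc idx) false d t k (s≤s⁻¹ (s≤s⁻¹ (subst (_≤ 2 + weight (take t d)) (suc+suc (suc k)) reached)))
  ... | i , refl , before = fsuc i , refl , <-shift idx t before
  tens-reach idx true  (false ∷ d) (suc t) k reached with tens-reach (suc idx) true d t k reached
  ... | i , eq , before = i , eq , <-shift idx t before
  tens-reach idx false (true  ∷ d) (suc t) k reached with tens-reach (suc idx) true d t k reached
  ... | i , eq , before = i , eq , <-shift idx t before
  tens-reach idx false (false ∷ d) (suc t) k reached with tens-reach (suc idx) false d t k reached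
  ... | i , eq , before = i , eq , <-shift idx t before

  Ballot : ℕ → ℕ → Bool → List Bool → Set
  Ballot m n f d = ∀ j → j < n → bit f + weight (take (m * suc j) d) < suc j + suc j

  ballot? : ∀ m n f d → Dec (Ballot m n f d)
  ballot? m n f d = ∀<? n λ j → bit f + weight (take (m * suc j) d) <? suc j + suc j

  ballots : ℕ → ℕ → List Bool → ℕ
  ballots m n d = 𝟙[ ballot? m n true d ] + 𝟙[ ballot? m n false d ]

  Cond1⇒Ballot : ∀ s n f d → Cond1 s (f ∷ applyChanges f d) → Ballot (s + 2) n f d
  Cond1⇒Ballot s n f d cond j _ = decidable-stable (_ <? _) λ ¬below →
    let i , i≡j , before = tens-reach 1 f d ((s + 2) * suc j) j (≮⇒≥ ¬below)
        here : ℕ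
        here = lookup (tens 1 f d) i
    in <⇒≱ (subst (here <_) (+-comm 1 _) before) (subst (λ j → (s + 2) * suc j + 1 ≤ here) i≡j (cond i))

  Ballot-extends : ∀ m n f d → 1 ≤ n → length d ≡ m * n → Ballot m n f d →
                   ∀ k → bit f + weight (take (m * suc k) d) < suc k + suc k
  Ballot-extends m (suc n) f d _ len ballot k with k <? suc n
  ... | yes k<n = ballot k k<n
  ... | no  k≮n = begin-strict
    bit f + weight (take (m * suc k) d)
      ≡⟨ cong (λ xs → bit f + weight xs) (trans (take-all _ d d≤) (sym (take-all _ d (≤-reflexive len)))) ⟩
    bit f + weight (take (m * suc n) d) <⟨ ballot n ≤-refl ⟩
    suc n + suc n                       ≤⟨ +-mono-≤ n<k+1 n<k+1 ⟩
    suc k + suc k                       ∎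
    where
    open ≤-Reasoning
    n<k+1 : suc n ≤ suc k
    n<k+1 = m≤n⇒m≤1+n (≮⇒≥ k≮n)
    d≤ : length d ≤ m * suc k
    d≤ = ≤-trans (≤-reflexive len) (*-monoʳ-≤ m n<k+1)

  Ballot⇒Cond1 : ∀ s n f d → 1 ≤ n → length d ≡ (s + 2) * n → Ballot (s + 2) n f d → Cond1 s (f ∷ applyChanges f d)
  Ballot⇒Cond1 s n f d 1≤n len ballot k =
    let p , eq , reached = lookup-tens 1 f d k
        late : (s + 2) * suc (toℕ k) ≤ p
        late = decidable-stable (_ ≤? p) λ early →
          <⇒≱ (Ballot-extends (s + 2) n f d 1≤n len ballot (toℕ k))
              (≤-trans reached (+-monoʳ-≤ (bit f) (weight-take-mono d (≰⇒> early))))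
    in subst₂ _≤_ (+-comm 1 _) (sym eq) (s≤s late)

module Walks where

  open import Data.Nat as ℕ using (ℕ; zero; suc; z≤n; s≤s)
  import Data.Nat.Properties as ℕₚ
  open import Data.Integer hiding (suc)
  open import Data.Integer.Properties
  open import Data.Integer.Tactic.RingSolver using (solve-∀)
  open import Data.Sum using ([_,_]′)
  open import Relation.Nullary using (Dec; yes; no; contradiction)
  open import Relation.Binary.PropositionalEquality
  open import Function using (_⇔_; mk⇔)
  open Sums

  <+1⇒≤ : ∀ {i j} → i < j + + 1 → i ≤ j
  <+1⇒≤ {i} {j} i<j+1 = subst (i ≤_) (pred-+1 j) (i<j⇒i≤pred[j] i<j+1)
    where
    pred-+1 : ∀ j → - + 1 + (j + + 1) ≡ j
    pred-+1 = solve-∀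

  private
    gap : ∀ z k → k ≡ (z + k) - z
    gap = solve-∀

  +-cancelˡ-≤ : ∀ x {y z} → x + y ≤ x + z → y ≤ z
  +-cancelˡ-≤ x {y} {z} x+y≤x+z = subst₂ _≤_ (cancel x y) (cancel x z) (+-monoʳ-≤ (- x) x+y≤x+z)
    where
    cancel : ∀ x y → - x + (x + y) ≡ y
    cancel = solve-∀

  +k≤+b-+o⇔o+k≤b : ∀ k b o → + k ≤ + b - + o ⇔ o ℕ.+ k ℕ.≤ b
  +k≤+b-+o⇔o+k≤b k b o = mk⇔
    (λ k≤b-o → drop‿+≤+ (subst (+ o + + k ≤_) (cancel (+ o) (+ b)) (+-monoʳ-≤ (+ o) k≤b-o)))
    (λ o+k≤b → subst (_≤ + b - + o) (sym (gap (+ o) (+ k))) (+-monoˡ-≤ (- + o) (+≤+ o+k≤b)))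
    where
    cancel : ∀ o b → o + (b - o) ≡ b
    cancel = solve-∀

  𝟙[z+2≤w]+𝟙[z+1≤w]≡w-z⊓w : ∀ z w → w ≤ z + + 2 →
                             + (𝟙[ z + + 2 ≤? w ] ℕ.+ 𝟙[ z + + 1 ≤? w ]) ≡ w - z ⊓ w
  𝟙[z+2≤w]+𝟙[z+1≤w]≡w-z⊓w z w w≤z+2 with z + + 2 ≤? w | z + + 1 ≤? w
  ... | yes z+2≤w | no z+1≰w = contradiction (≤-trans (+-monoʳ-≤ z (+≤+ (s≤s z≤n))) z+2≤w) z+1≰w
  ... | yes z+2≤w | yes _ = begin
    + 2                  ≡⟨ gap z (+ 2) ⟩
    (z + + 2) - z        ≡⟨ cong₂ _-_ (sym w≡z+2) (sym (i≤j⇒i⊓j≡i (≤-trans (i≤i+j z (+ 2)) z+2≤w))) ⟩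
    w - z ⊓ w            ∎
    where
    open ≡-Reasoning
    w≡z+2 : w ≡ z + + 2
    w≡z+2 = ≤-antisym w≤z+2 z+2≤w
  ... | no z+2≰w | yes z+1≤w = begin
    + 1                  ≡⟨ gap z (+ 1) ⟩
    (z + + 1) - z        ≡⟨ cong₂ _-_ (sym w≡z+1) (sym (i≤j⇒i⊓j≡i (≤-trans (i≤i+j z (+ 1)) z+1≤w))) ⟩
    w - z ⊓ w            ∎
    where
    open ≡-Reasoning
    w≡z+1 : w ≡ z + + 1
    w≡z+1 = ≤-antisym (<+1⇒≤ (subst (w <_) (sym (+-assoc z (+ 1) (+ 1))) (≰⇒> z+2≰w))) z+1≤w
  ... | no _ | no z+1≰w = begin
    + 0                  ≡⟨ sym (+-inverseʳ w) ⟩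
    w - w                ≡⟨ cong (λ x → w - x) (sym (i≥j⇒i⊓j≡j (<+1⇒≤ (≰⇒> z+1≰w)))) ⟩
    w - z ⊓ w            ∎
    where open ≡-Reasoning

  telescope : ∀ k (g : ℕ → ℕ) (W : ℕ → ℤ) → (∀ i → i ℕ.< k → + g i ≡ W (suc i) - W i) →
              + ∑< k g ≡ W k - W 0
  telescope zero    g W step = sym (+-inverseʳ (W 0))
  telescope (suc k) g W step = begin
    + ∑< k g + + g k
      ≡⟨ cong₂ _+_ (telescope k g W λ i i<k → step i (ℕₚ.m<n⇒m<1+n i<k)) (step k ℕₚ.≤-refl) ⟩
    (W k - W 0) + (W (suc k) - W k)
      ≡⟨ chain (W 0) (W k) (W (suc k)) ⟩
    W (suc k) - W 0 ∎
    where
    open ≡-Reasoning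
    chain : ∀ a b c → (b - a) + (c - b) ≡ c - a
    chain = solve-∀

  -- The window minimum W i = min (Z i, …, Z (i + n)) satisfies W i = Z i ⊓ W (i + 1) by periodicity, so
  -- W (i + 1) − W i counts the k ∈ {1, 2} for which Z stays k above Z i; these counts telescope to D.
  module CycleLemma (Z : ℕ → ℤ) (n′ : ℕ) (D : ℤ)
      (step≤2   : ∀ t → t ℕ.< suc n′ → Z (suc t) ≤ Z t + + 2)
      (periodic : ∀ t → t ℕ.≤ suc n′ → Z (suc n′ ℕ.+ t) ≡ Z t + D)
      (0≤D      : + 0 ≤ D) where

    private
      n : ℕ
      n = suc n′

    windowMin : ℕ → ℕ → ℤ
    windowMin i zero    = Z i
    windowMin i (suc k) = Z i ⊓ windowMin (suc i) k

    windowMin-≤ : ∀ i {k j} → j ℕ.≤ k → windowMin i k ≤ Z (j ℕ.+ i)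
    windowMin-≤ i {zero}          z≤n       = ≤-refl
    windowMin-≤ i {suc k}         z≤n       = i⊓j≤i (Z i) (windowMin (suc i) k)
    windowMin-≤ i {suc k} {suc j} (s≤s j≤k) =
      ≤-trans (i⊓j≤j (Z i) (windowMin (suc i) k))
              (subst (λ t → windowMin (suc i) k ≤ Z t) (ℕₚ.+-suc j i) (windowMin-≤ (suc i) j≤k))

    ≤-windowMin : ∀ i k {b} → (∀ j → j ℕ.≤ k → b ≤ Z (j ℕ.+ i)) → b ≤ windowMin i k
    ≤-windowMin i zero    below = below 0 z≤n
    ≤-windowMin i (suc k) {b} below = ⊓-glb (below 0 z≤n) (≤-windowMin (suc i) k λ j j≤k →
      subst (λ t → b ≤ Z t) (sym (ℕₚ.+-suc j i)) (below (suc j) (s≤s j≤k)))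

    windowMin-periodic : ∀ k i → i ℕ.+ k ℕ.≤ n → windowMin (n ℕ.+ i) k ≡ windowMin i k + D
    windowMin-periodic zero    i i≤n   = periodic i (subst (ℕ._≤ n) (ℕₚ.+-identityʳ i) i≤n)
    windowMin-periodic (suc k) i i+k<n = begin
      Z (n ℕ.+ i) ⊓ windowMin (suc (n ℕ.+ i)) k
        ≡⟨ cong₂ _⊓_ (periodic i (ℕₚ.≤-trans (ℕₚ.m≤m+n i (suc k)) i+k<n))
                     (trans (cong (λ t → windowMin t k) (sym (ℕₚ.+-suc n i)))
                            (windowMin-periodic k (suc i) (subst (ℕ._≤ n) (ℕₚ.+-suc i k) i+k<n))) ⟩
      (Z i + D) ⊓ (windowMin (suc i) k + D)
        ≡⟨ sym (mono-≤-distrib-⊓ (+-monoˡ-≤ D) (Z i) (windowMin (suc i) k)) ⟩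
      (Z i ⊓ windowMin (suc i) k) + D ∎
      where open ≡-Reasoning

    W : ℕ → ℤ
    W i = windowMin i n

    Z≤Z[n+t] : ∀ t → t ℕ.≤ n → Z t ≤ Z (n ℕ.+ t)
    Z≤Z[n+t] t t≤n = subst (Z t ≤_) (sym (periodic t t≤n)) (i≤i+j (Z t) D {{nonNegative 0≤D}})

    W-step : ∀ i → i ℕ.< n → W i ≡ Z i ⊓ W (suc i)
    W-step i i<n = cong (Z i ⊓_) (≤-antisym
      (≤-windowMin (suc i) n λ j j≤n → [ (λ j<n → windowMin-≤ (suc i) (ℕ.s≤s⁻¹ j<n))
                                       , (λ { refl → ≤-trans (windowMin-≤ (suc i) {n′} z≤n) (Z≤Z[n+t] (suc i) i<n) }) ]′
                                       (ℕₚ.m≤n⇒m<n∨m≡n j≤n))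
      (≤-windowMin (suc i) n′ λ j j≤n′ → windowMin-≤ (suc i) (ℕₚ.m≤n⇒m≤1+n j≤n′)))

    StaysAbove : ℕ → ℕ → Set
    StaysAbove k i = ∀ j → j ℕ.< n → Z i + + k ≤ Z (j ℕ.+ suc i)

    staysAbove? : ∀ k i → Dec (StaysAbove k i)
    staysAbove? k i = ∀<? n λ j → Z i + + k ≤? Z (j ℕ.+ suc i)

    StaysAbove⇔≤W : ∀ k i → i ℕ.< n → StaysAbove k i ⇔ Z i + + k ≤ W (suc i)
    StaysAbove⇔≤W k i i<n = mk⇔
      (λ above → ≤-windowMin (suc i) n λ j j≤n →
        [ above j , (λ { refl → ≤-trans (above 0 (s≤s z≤n)) (Z≤Z[n+t] (suc i) i<n) }) ]′ (ℕₚ.m≤n⇒m<n∨m≡n j≤n))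
      (λ below j j<n → ≤-trans below (windowMin-≤ (suc i) (ℕₚ.<⇒≤ j<n)))

    W-rise : ∀ i → i ℕ.< n → + (𝟙[ staysAbove? 2 i ] ℕ.+ 𝟙[ staysAbove? 1 i ]) ≡ W (suc i) - W i
    W-rise i i<n = begin
      + (𝟙[ staysAbove? 2 i ] ℕ.+ 𝟙[ staysAbove? 1 i ])
        ≡⟨ cong₂ (λ a b → + (a ℕ.+ b)) (𝟙-cong (staysAbove? 2 i) (Z i + + 2 ≤? W (suc i)) (StaysAbove⇔≤W 2 i i<n))
                                       (𝟙-cong (staysAbove? 1 i) (Z i + + 1 ≤? W (suc i)) (StaysAbove⇔≤W 1 i i<n)) ⟩
      + (𝟙[ Z i + + 2 ≤? W (suc i) ] ℕ.+ 𝟙[ Z i + + 1 ≤? W (suc i) ])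
        ≡⟨ 𝟙[z+2≤w]+𝟙[z+1≤w]≡w-z⊓w (Z i) (W (suc i)) (≤-trans (windowMin-≤ (suc i) {n} z≤n) (step≤2 i i<n)) ⟩
      W (suc i) - Z i ⊓ W (suc i)
        ≡⟨ cong (λ x → W (suc i) - x) (sym (W-step i i<n)) ⟩
      W (suc i) - W i ∎
      where open ≡-Reasoning

    cycle-lemma : + ∑[ i < n ] (𝟙[ staysAbove? 2 i ] ℕ.+ 𝟙[ staysAbove? 1 i ]) ≡ D
    cycle-lemma = begin
      + ∑[ i < n ] (𝟙[ staysAbove? 2 i ] ℕ.+ 𝟙[ staysAbove? 1 i ])
        ≡⟨ telescope n _ W W-rise ⟩
      W n - W 0
        ≡⟨ cong (λ x → x - W 0) (trans (cong (λ t → windowMin t n) (sym (ℕₚ.+-identityʳ n)))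
                                       (windowMin-periodic n 0 ℕₚ.≤-refl)) ⟩
      (W 0 + D) - W 0
        ≡⟨ cancel (W 0) D ⟩
      D ∎
      where
      open ≡-Reasoning
      cancel : ∀ a d → (a + d) - a ≡ d
      cancel = solve-∀

module Binomials where

  open import Data.Nat
  open import Data.Nat.Properties
  open import Data.Nat.Combinatorics using (_C_; nCk+nC[k+1]≡[n+1]C[k+1]; nC1≡n; k>n⇒nCk≡0)
  open import Relation.Binary.PropositionalEquality

  shift : (ℕ → ℕ) → ℕ → ℕ
  shift B zero    = 0
  shift B (suc c) = B c

  C-pascal : ∀ M c → suc M C c ≡ M C c + shift (M C_) c
  C-pascal M zero    = refl
  C-pascal M (suc c) = trans (sym (nCk+nC[k+1]≡[n+1]C[k+1] M c)) (+-comm (M C c) (M C suc c))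

  [k+1]*[n+1]C[k+1]≡[n+1]*nCk : ∀ n k → suc k * (suc n C suc k) ≡ suc n * (n C k)
  [k+1]*[n+1]C[k+1]≡[n+1]*nCk zero    zero    = refl
  [k+1]*[n+1]C[k+1]≡[n+1]*nCk zero    (suc k) =
    trans (cong (suc (suc k) *_) (k>n⇒nCk≡0 {1} {suc (suc k)} (s≤s (s≤s z≤n)))) (*-zeroʳ (suc (suc k)))
  [k+1]*[n+1]C[k+1]≡[n+1]*nCk (suc n) zero    =
    trans (*-identityˡ (suc (suc n) C 1)) (trans (nC1≡n (suc (suc n))) (sym (*-identityʳ (suc (suc n)))))
  [k+1]*[n+1]C[k+1]≡[n+1]*nCk (suc n) (suc k) = begin
    suc (suc k) * (suc (suc n) C suc (suc k))
      ≡⟨ cong (suc (suc k) *_) (sym (nCk+nC[k+1]≡[n+1]C[k+1] (suc n) (suc k))) ⟩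
    suc (suc k) * (suc n C suc k + suc n C suc (suc k))
      ≡⟨ *-distribˡ-+ (suc (suc k)) (suc n C suc k) (suc n C suc (suc k)) ⟩
    suc n C suc k + suc k * (suc n C suc k) + suc (suc k) * (suc n C suc (suc k))
      ≡⟨ cong₂ (λ x y → suc n C suc k + x + y) ([k+1]*[n+1]C[k+1]≡[n+1]*nCk n k)
                                                ([k+1]*[n+1]C[k+1]≡[n+1]*nCk n (suc k)) ⟩
    suc n C suc k + suc n * (n C k) + suc n * (n C suc k)
      ≡⟨ +-assoc (suc n C suc k) _ _ ⟩
    suc n C suc k + (suc n * (n C k) + suc n * (n C suc k))
      ≡⟨ cong (suc n C suc k +_) (sym (*-distribˡ-+ (suc n) (n C k) (n C suc k))) ⟩
    suc n C suc k + suc n * (n C k + n C suc k)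
      ≡⟨ cong (λ x → suc n C suc k + suc n * x) (nCk+nC[k+1]≡[n+1]C[k+1] n k) ⟩
    suc (suc n) * (suc n C suc k) ∎
    where open ≡-Reasoning

  C-absorption : ∀ M c → c * (suc M C c) ≡ suc M * shift (M C_) c
  C-absorption M zero    = sym (*-zeroʳ (suc M))
  C-absorption M (suc c) = [k+1]*[n+1]C[k+1]≡[n+1]*nCk M c

module BinomialCombinations where

  open import Data.Nat as ℕ using (ℕ; zero; suc; z≤n)
  import Data.Nat.Properties as ℕₚ
  open import Data.Nat.Combinatorics using (_C_)
  open import Data.Integer hiding (suc)
  open import Data.Integer.Properties
  open import Data.Integer.Tactic.RingSolver using (solve-∀)
  open import Relation.Binary.PropositionalEquality
  open Sums
  open Binomials

  ∑-shift-combination : ∀ (X B : ℕ → ℕ) s r → (∀ c → c ℕ.≤ r → + X c ≡ + 2 * + B c - + s * + shift B c) →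
                        + ∑[ c < suc r ] X c ≡ + 2 * + B r - (+ s - + 2) * + ∑< r B
  ∑-shift-combination X B s zero    X≡ = trans (X≡ 0 z≤n) (first (+ B 0) (+ s))
    where
    first : ∀ b s → + 2 * b - s * + 0 ≡ + 2 * b - (s - + 2) * + 0
    first = solve-∀
  ∑-shift-combination X B s (suc r) X≡ = begin
    + ∑[ c < suc r ] X c + + X (suc r)
      ≡⟨ cong₂ _+_ (∑-shift-combination X B s r λ c c≤r → X≡ c (ℕₚ.m≤n⇒m≤1+n c≤r))
                   (X≡ (suc r) ℕₚ.≤-refl) ⟩
    (+ 2 * + B r - (+ s - + 2) * + ∑< r B) + (+ 2 * + B (suc r) - + s * + B r)
      ≡⟨ next (+ B r) (+ B (suc r)) (+ s) (+ ∑< r B) ⟩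
    + 2 * + B (suc r) - (+ s - + 2) * (+ ∑< r B + + B r) ∎
    where
    open ≡-Reasoning
    next : ∀ b b′ s S → (+ 2 * b - (s - + 2) * S) + (+ 2 * b′ - s * b) ≡ + 2 * b′ - (s - + 2) * (S + b)
    next = solve-∀

  C-quotient : ∀ M s n′ c X → suc M ≡ (s ℕ.+ 2) ℕ.* suc n′ → c ℕ.≤ suc n′ ℕ.+ suc n′ →
               suc n′ ℕ.* X ≡ (suc n′ ℕ.+ suc n′ ℕ.∸ c) ℕ.* (suc M C c) →
               + X ≡ + 2 * + (M C c) - + s * + shift (M C_) c
  C-quotient M s n′ c X N≡ c≤2n nX≡ = *-cancelˡ-≡ (+ n) (+ X) _ (begin
    + n * + X                               ≡⟨ sym (pos-* n X) ⟩
    + (n ℕ.* X)                             ≡⟨ cong +_ nX≡ ⟩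
    + ((n ℕ.+ n ℕ.∸ c) ℕ.* (suc M C c))     ≡⟨ pos-* (n ℕ.+ n ℕ.∸ c) (suc M C c) ⟩
    + (n ℕ.+ n ℕ.∸ c) * + (suc M C c)
      ≡⟨ cong₂ _*_ (sym (trans (m-n≡m⊖n (n ℕ.+ n) c) (⊖-≥ c≤2n))) (cong +_ (C-pascal M c)) ⟩
    (+ n + + n - + c) * (+ b + + p)         ≡⟨ rearrange (+ n) (+ s) (+ b) (+ p) (+ c) absorbed ⟩
    + n * (+ 2 * + b - + s * + p)           ∎)
    where
    open ≡-Reasoning
    n : ℕ
    n = suc n′
    b : ℕ
    b = M C c
    p : ℕ
    p = shift (M C_) c
    absorbed : + c * (+ b + + p) ≡ (+ s + + 2) * + n * + p
    absorbed = begin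
      + c * + (b ℕ.+ p)             ≡⟨ sym (pos-* c (b ℕ.+ p)) ⟩
      + (c ℕ.* (b ℕ.+ p))           ≡⟨ cong (λ x → + (c ℕ.* x)) (sym (C-pascal M c)) ⟩
      + (c ℕ.* (suc M C c))         ≡⟨ cong +_ (C-absorption M c) ⟩
      + (suc M ℕ.* p)               ≡⟨ cong (λ x → + (x ℕ.* p)) N≡ ⟩
      + ((s ℕ.+ 2) ℕ.* n ℕ.* p)     ≡⟨ pos-* ((s ℕ.+ 2) ℕ.* n) p ⟩
      + ((s ℕ.+ 2) ℕ.* n) * + p     ≡⟨ cong (_* + p) (pos-* (s ℕ.+ 2) n) ⟩
      (+ s + + 2) * + n * + p       ∎
    rearrange : ∀ n s b p c → c * (b + p) ≡ (s + + 2) * n * p → (n + n - c) * (b + p) ≡ n * (+ 2 * b - s * p)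
    rearrange n s b p c c[b+p]≡ = begin
      (n + n - c) * (b + p)                    ≡⟨ expand n b p c ⟩
      (n + n) * (b + p) - c * (b + p)          ≡⟨ cong (λ x → (n + n) * (b + p) - x) c[b+p]≡ ⟩
      (n + n) * (b + p) - (s + + 2) * n * p    ≡⟨ collect n s b p ⟩
      n * (+ 2 * b - s * p)                    ∎
      where
      expand : ∀ n b p c → (n + n - c) * (b + p) ≡ (n + n) * (b + p) - c * (b + p)
      expand = solve-∀
      collect : ∀ n s b p → (n + n) * (b + p) - (s + + 2) * n * p ≡ n * (+ 2 * b - s * p)
      collect = solve-∀

open import Data.Nat using (ℕ; _≤_; _∸_)
open import Data.Nat.Combinatorics using (_C_)
open import Data.Integer using (ℤ; +_; _-_)
open import Data.List using (map; upTo)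
open import Data.Nat.ListAction using (sum)
open import Relation.Binary.PropositionalEquality using (_≡_)

open import Data.Bool using (Bool; true; false)
open import Data.Nat using (suc; _+_; _*_; _<_; _≟_; _<?_; z≤n; s≤s; s≤s⁻¹)
open import Data.Nat.Properties
import Data.Nat.Tactic.RingSolver as ℕ-Solver
open import Data.Integer as ℤ using (+≤+)
import Data.Integer.Properties as ℤₚ
open import Data.Integer.Tactic.RingSolver using (solve-∀)
open import Data.List using (List; _∷_; _++_; length; take)
open import Data.Product using (_×_; _,_)
open import Relation.Nullary using (Dec; yes; no)
open import Relation.Nullary.Decidable using (_×-dec_)
open import Relation.Binary.PropositionalEquality
open import Function using (_⇔_; mk⇔; Equivalence)
open Sums
open BitStrings
open TenPositions
open Walks using (module CycleLemma; +k≤+b-+o⇔o+k≤b)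
open Binomials using (shift)
open BinomialCombinations using (∑-shift-combination; C-quotient)

module BallotRotations (m n′ : ℕ) (d : List Bool) (len : length d ≡ m * suc n′)
                       (w≤2n : weight d ≤ suc n′ + suc n′) where

  private
    n : ℕ
    n = suc n′

  prefixWeight : ℕ → ℕ
  prefixWeight t = weight (take (m * t) (d ++ d))

  Z : ℕ → ℤ
  Z t = + (t + t) - + prefixWeight t

  m*t≤len : ∀ {t} → t ≤ n → m * t ≤ length d
  m*t≤len t≤n = ≤-trans (*-monoʳ-≤ m t≤n) (≤-reflexive (sym len))

  prefixWeight-short : ∀ {t} → t ≤ n → prefixWeight t ≡ weight (take (m * t) d)
  prefixWeight-short t≤n = cong weight (take-++-≤ d d _ (m*t≤len t≤n))

  Z-step≤2 : ∀ t → Z (suc t) ℤ.≤ Z t ℤ.+ + 2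
  Z-step≤2 t = begin
    + (suc t + suc t) - + prefixWeight (suc t)
      ≤⟨ ℤₚ.+-monoʳ-≤ (+ (suc t + suc t))
                      (ℤₚ.neg-mono-≤ (+≤+ (weight-take-mono (d ++ d) (*-monoʳ-≤ m (n≤1+n t))))) ⟩
    + (suc t + suc t) - + prefixWeight t
      ≡⟨ cong (λ k → + k - + prefixWeight t) (suc+suc t) ⟩
    (+ (t + t) ℤ.+ + 2) - + prefixWeight t
      ≡⟨ lift-2 (+ (t + t)) (+ prefixWeight t) ⟩
    Z t ℤ.+ + 2 ∎
    where
    open ℤₚ.≤-Reasoning
    suc+suc : ∀ t → suc t + suc t ≡ (t + t) + 2
    suc+suc = ℕ-Solver.solve-∀
    lift-2 : ∀ a p → (a ℤ.+ + 2) - p ≡ (a - p) ℤ.+ + 2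
    lift-2 = solve-∀

  Z-periodic : ∀ t → t ≤ n → Z (n + t) ≡ Z t ℤ.+ + (n + n ∸ weight d)
  Z-periodic t t≤n = begin
    + ((n + t) + (n + t)) - + prefixWeight (n + t)
      ≡⟨ cong₂ (λ a p → + a - + p) (regroup n t) prefixWeight-n+t ⟩
    (+ (t + t) ℤ.+ + (n + n)) - (+ weight d ℤ.+ + weight (take (m * t) d))
      ≡⟨ swap (+ (t + t)) (+ (n + n)) (+ weight d) (+ weight (take (m * t) d)) ⟩
    (+ (t + t) - + weight (take (m * t) d)) ℤ.+ (+ (n + n) - + weight d)
      ≡⟨ cong₂ (λ p D → (+ (t + t) - + p) ℤ.+ D) (sym (prefixWeight-short t≤n))
               (trans (ℤₚ.m-n≡m⊖n (n + n) (weight d)) (ℤₚ.⊖-≥ w≤2n)) ⟩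
    Z t ℤ.+ + (n + n ∸ weight d) ∎
    where
    open ≡-Reasoning
    regroup : ∀ n t → (n + t) + (n + t) ≡ (t + t) + (n + n)
    regroup = ℕ-Solver.solve-∀
    swap : ∀ a b c p → (a ℤ.+ b) - (c ℤ.+ p) ≡ (a - p) ℤ.+ (b - c)
    swap = solve-∀
    prefixWeight-n+t : prefixWeight (n + t) ≡ weight d + weight (take (m * t) d)
    prefixWeight-n+t = begin
      weight (take (m * (n + t)) (d ++ d))
        ≡⟨ cong (λ k → weight (take k (d ++ d))) (trans (*-distribˡ-+ m n t) (cong (_+ m * t) (sym len))) ⟩
      weight (take (length d + m * t) (d ++ d))  ≡⟨ cong weight (take-length-++ d d (m * t)) ⟩
      weight (d ++ take (m * t) d)               ≡⟨ weight-++ d (take (m * t) d) ⟩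
      weight d + weight (take (m * t) d)         ∎

  open CycleLemma Z n′ (+ (n + n ∸ weight d)) (λ t _ → Z-step≤2 t) Z-periodic (+≤+ z≤n)

  rotatedWeight : ℕ → ℕ → ℕ
  rotatedWeight i j = weight (take (m * suc j) (rotate (m * i) d))

  Z-rotate : ∀ i j → i < n → j < n → Z (j + suc i) ≡ Z i ℤ.+ (+ (suc j + suc j) - + rotatedWeight i j)
  Z-rotate i j i<n j<n = begin
    + ((j + suc i) + (j + suc i)) - + prefixWeight (j + suc i)
      ≡⟨ cong₂ (λ a p → + a - + p) (regroup i j) (sym prefixWeight-split) ⟩
    (+ (i + i) ℤ.+ + (suc j + suc j)) - (+ O ℤ.+ + weight (take (m * i) d))
      ≡⟨ swap (+ (i + i)) (+ (suc j + suc j)) (+ O) (+ weight (take (m * i) d)) ⟩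
    (+ (i + i) - + weight (take (m * i) d)) ℤ.+ (+ (suc j + suc j) - + O)
      ≡⟨ cong (λ p → (+ (i + i) - + p) ℤ.+ (+ (suc j + suc j) - + O)) (sym (prefixWeight-short (<⇒≤ i<n))) ⟩
    Z i ℤ.+ (+ (suc j + suc j) - + O) ∎
    where
    open ≡-Reasoning
    O : ℕ
    O = rotatedWeight i j
    regroup : ∀ i j → (j + suc i) + (j + suc i) ≡ (i + i) + (suc j + suc j)
    regroup = ℕ-Solver.solve-∀
    swap : ∀ a b c p → (a ℤ.+ b) - (c ℤ.+ p) ≡ (a - p) ℤ.+ (b - c)
    swap = solve-∀
    m*-split : ∀ m i j → m * i + m * suc j ≡ m * (j + suc i)
    m*-split = ℕ-Solver.solve-∀
    prefixWeight-split : O + weight (take (m * i) d) ≡ prefixWeight (j + suc i)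
    prefixWeight-split = trans (weight-take-rotate d (m * i) (m * suc j) (m*t≤len (<⇒≤ i<n)) (m*t≤len j<n))
                               (cong (λ k → weight (take k (d ++ d))) (m*-split m i j))

  ballot-step⇔ : ∀ f i j → i < n → j < n →
                 bit f + rotatedWeight i j < suc j + suc j ⇔ Z i ℤ.+ + suc (bit f) ℤ.≤ Z (j + suc i)
  ballot-step⇔ f i j i<n j<n = mk⇔
    (λ below → subst (Z i ℤ.+ + suc (bit f) ℤ.≤_) (sym (Z-rotate i j i<n j<n))
                 (ℤₚ.+-monoʳ-≤ (Z i) (Equivalence.from gap⇔ (subst (_≤ b) (sym +suc) below))))
    (λ above → subst (_≤ b) +suc (Equivalence.to gap⇔
                 (Walks.+-cancelˡ-≤ (Z i) (subst (Z i ℤ.+ + suc (bit f) ℤ.≤_) (Z-rotate i j i<n j<n) above))))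
    where
    O : ℕ
    O = rotatedWeight i j
    b : ℕ
    b = suc j + suc j
    gap⇔ : + suc (bit f) ℤ.≤ + b - + O ⇔ O + suc (bit f) ≤ b
    gap⇔ = +k≤+b-+o⇔o+k≤b (suc (bit f)) b O
    +suc : O + suc (bit f) ≡ suc (bit f + O)
    +suc = trans (+-suc O (bit f)) (cong suc (+-comm O (bit f)))

  Ballot-rotate⇔StaysAbove : ∀ f i → i < n → Ballot m n f (rotate (m * i) d) ⇔ StaysAbove (suc (bit f)) i
  Ballot-rotate⇔StaysAbove f i i<n = mk⇔
    (λ ballot j j<n → Equivalence.to   (ballot-step⇔ f i j i<n j<n) (ballot j j<n))
    (λ above  j j<n → Equivalence.from (ballot-step⇔ f i j i<n j<n) (above j j<n))

  ballot-rotations : ∑[ i < n ] ballots m n (rotate (m * i) d) ≡ n + n ∸ weight d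
  ballot-rotations = ℤₚ.+-injective (trans (cong +_ (∑-cong n λ i i<n → cong₂ _+_
    (𝟙-cong (ballot? m n true  (rotate (m * i) d)) (staysAbove? 2 i) (Ballot-rotate⇔StaysAbove true  i i<n))
    (𝟙-cong (ballot? m n false (rotate (m * i) d)) (staysAbove? 1 i) (Ballot-rotate⇔StaysAbove false i i<n))))
    cycle-lemma)

ballotCount : ℕ → ℕ → ℕ → ℕ
ballotCount m n c = sumBits (m * n) λ d → ballots m n d * 𝟙[ weight d ≟ c ]

n*ballotCount≡ : ∀ m n′ c → c ≤ suc n′ + suc n′ →
                 suc n′ * ballotCount m (suc n′) c ≡ (suc n′ + suc n′ ∸ c) * (m * suc n′ C c)
n*ballotCount≡ m n′ c c≤2n = begin
  n * sumBits N H                                   ≡⟨ sym (∑-const n (sumBits N H)) ⟩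
  ∑[ i < n ] sumBits N H                            ≡⟨ ∑-cong n (λ i _ → sym (sumBits-rotate (m * i) N H)) ⟩
  ∑[ i < n ] sumBits N (λ d → H (rotate (m * i) d)) ≡⟨ sym (sumBits-∑ N n λ i d → H (rotate (m * i) d)) ⟩
  sumBits N (λ d → ∑[ i < n ] H (rotate (m * i) d)) ≡⟨ sumBits-cong N rotations ⟩
  sumBits N (λ d → (n + n ∸ c) * 𝟙[ weight d ≟ c ]) ≡⟨ sumBits-*ˡ N (n + n ∸ c) (λ d → 𝟙[ weight d ≟ c ]) ⟩
  (n + n ∸ c) * sumBits N (λ d → 𝟙[ weight d ≟ c ]) ≡⟨ cong ((n + n ∸ c) *_) (sumBits-weight≡C N c) ⟩
  (n + n ∸ c) * (N C c)                             ∎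
  where
  open ≡-Reasoning
  n : ℕ
  n = suc n′
  N : ℕ
  N = m * n
  H : List Bool → ℕ
  H d = ballots m n d * 𝟙[ weight d ≟ c ]
  rotations : ∀ d → length d ≡ N → ∑[ i < n ] H (rotate (m * i) d) ≡ (n + n ∸ c) * 𝟙[ weight d ≟ c ]
  rotations d len = begin
    ∑[ i < n ] H (rotate (m * i) d)
      ≡⟨ ∑-cong n (λ i _ → cong (λ w → ballots m n (rotate (m * i) d) * 𝟙[ w ≟ c ]) (weight-rotate (m * i) d)) ⟩
    ∑[ i < n ] (ballots m n (rotate (m * i) d) * 𝟙[ weight d ≟ c ])
      ≡⟨ ∑-*ʳ n 𝟙[ weight d ≟ c ] (λ i → ballots m n (rotate (m * i) d)) ⟩
    ∑[ i < n ] ballots m n (rotate (m * i) d) * 𝟙[ weight d ≟ c ]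
      ≡⟨ by-weight (weight d ≟ c) ⟩
    (n + n ∸ c) * 𝟙[ weight d ≟ c ] ∎
    where
    by-weight : (w≟c : Dec (weight d ≡ c)) →
                ∑[ i < n ] ballots m n (rotate (m * i) d) * 𝟙[ w≟c ] ≡ (n + n ∸ c) * 𝟙[ w≟c ]
    by-weight (yes refl) = cong (_* 1) (BallotRotations.ballot-rotations m n′ d len c≤2n)
    by-weight (no _)     = trans (*-zeroʳ (∑[ i < n ] ballots m n (rotate (m * i) d))) (sym (*-zeroʳ (n + n ∸ c)))

ballotCount≡ : ∀ s n′ c → c ≤ 2 * suc n′ → let M = (s + 2) * suc n′ ∸ 1 in
               + ballotCount (s + 2) (suc n′) c ≡ + 2 ℤ.* + (M C c) - + s ℤ.* + shift (M C_) c
ballotCount≡ s n′ c c≤2n =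
  C-quotient M s n′ c (ballotCount (s + 2) n c) N≡ c≤n+n
    (trans (n*ballotCount≡ (s + 2) n′ c c≤n+n) (cong (λ N → (n + n ∸ c) * (N C c)) (sym N≡)))
  where
  n : ℕ
  n = suc n′
  M : ℕ
  M = (s + 2) * n ∸ 1
  c≤n+n : c ≤ n + n
  c≤n+n = ≤-trans c≤2n (≤-reflexive (cong (λ k → n + k) (+-identityʳ n)))
  N≡ : suc M ≡ (s + 2) * n
  N≡ = trans (cong (λ k → suc (k ∸ 1)) (unfold s n′)) (sym (unfold s n′))
    where
    unfold : ∀ s n′ → (s + 2) * suc n′ ≡ suc (s + 1 + (s + 2) * n′)
    unfold = ℕ-Solver.solve-∀

Good⇔Ballot : ∀ s n r f d → 1 ≤ n → length d ≡ (s + 2) * n →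
              Good s r (f ∷ applyChanges f d) ⇔ (Ballot (s + 2) n f d × weight d < suc r)
Good⇔Ballot s n r f d 1≤n len = mk⇔
  (λ (cond1 , cond2) → Cond1⇒Ballot s n f d cond1 , s≤s (subst (_≤ r) (changes-applyChanges f d) cond2))
  (λ (ballot , w≤r) → Ballot⇒Cond1 s n f d 1≤n len ballot , subst (_≤ r) (sym (changes-applyChanges f d)) (s≤s⁻¹ w≤r))

a≡∑ballotCount : ∀ n s r → 1 ≤ n → a n s r ≡ ∑[ c < suc r ] ballotCount (s + 2) n c
a≡∑ballotCount n s r 1≤n = begin
  a n s r
    ≡⟨ length-filter-allBinary (N + 1) (good? s r) ⟩
  sumBits (N + 1) (λ b → 𝟙[ good? s r b ])
    ≡⟨ cong (λ L → sumBits L (λ b → 𝟙[ good? s r b ])) (+-comm N 1) ⟩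
  sumBits N (good-from true) + sumBits N (good-from false)
    ≡⟨ cong₂ _+_ (sym (sumBits-applyChanges N true (good-from true)))
                 (sym (sumBits-applyChanges N false (good-from false))) ⟩
  sumBits N (good-changes true) + sumBits N (good-changes false)
    ≡⟨ sym (sumBits-+ N (good-changes true) (good-changes false)) ⟩
  sumBits N (λ d → good-changes true d + good-changes false d)
    ≡⟨ sumBits-cong N split ⟩
  sumBits N (λ d → ∑[ c < suc r ] (ballots (s + 2) n d * 𝟙[ weight d ≟ c ]))
    ≡⟨ sumBits-∑ N (suc r) (λ c d → ballots (s + 2) n d * 𝟙[ weight d ≟ c ]) ⟩
  ∑[ c < suc r ] ballotCount (s + 2) n c ∎
  where
  open ≡-Reasoning
  N : ℕ
  N = (s + 2) * n
  good-from : Bool → List Bool → ℕ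
  good-from f b = 𝟙[ good? s r (f ∷ b) ]
  good-changes : Bool → List Bool → ℕ
  good-changes f d = good-from f (applyChanges f d)
  good-changes≡ : ∀ f d → length d ≡ N → good-changes f d ≡ 𝟙[ ballot? (s + 2) n f d ] * 𝟙[ weight d <? suc r ]
  good-changes≡ f d len =
    trans (𝟙-cong (good? s r (f ∷ applyChanges f d)) (ballot? (s + 2) n f d ×-dec (weight d <? suc r))
                  (Good⇔Ballot s n r f d 1≤n len))
          (𝟙-× (ballot? (s + 2) n f d) (weight d <? suc r))
  split : ∀ d → length d ≡ N →
          good-changes true d + good-changes false d ≡ ∑[ c < suc r ] (ballots (s + 2) n d * 𝟙[ weight d ≟ c ])
  split d len = begin
    good-changes true d + good-changes false d
      ≡⟨ cong₂ _+_ (good-changes≡ true d len) (good-changes≡ false d len) ⟩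
    𝟙[ ballot? (s + 2) n true d ] * 𝟙[ weight d <? suc r ] + 𝟙[ ballot? (s + 2) n false d ] * 𝟙[ weight d <? suc r ]
      ≡⟨ sym (*-distribʳ-+ 𝟙[ weight d <? suc r ] 𝟙[ ballot? (s + 2) n true d ] 𝟙[ ballot? (s + 2) n false d ]) ⟩
    ballots (s + 2) n d * 𝟙[ weight d <? suc r ]
      ≡⟨ cong (ballots (s + 2) n d *_) (𝟙[<]≡∑𝟙[≡] (weight d) (suc r)) ⟩
    ballots (s + 2) n d * ∑[ c < suc r ] 𝟙[ weight d ≟ c ]
      ≡⟨ sym (∑-*ˡ (suc r) (ballots (s + 2) n d) (λ c → 𝟙[ weight d ≟ c ])) ⟩
    ∑[ c < suc r ] (ballots (s + 2) n d * 𝟙[ weight d ≟ c ]) ∎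

theorem2 : (n s r : ℕ) → 1 ≤ n → r ≤ 2 Data.Nat.* n →
    + a n s r ≡
      (+ 2) Data.Integer.* (+ ((((s Data.Nat.+ 2) Data.Nat.* n) ∸ 1) C r))
      - (+ s - + 2) Data.Integer.* (+ sum (map (λ i → (((s Data.Nat.+ 2) Data.Nat.* n) ∸ 1) C i) (upTo r)))
theorem2 (suc n′) s r _ r≤2n = begin
  + a n s r
    ≡⟨ cong +_ (a≡∑ballotCount n s r (s≤s z≤n)) ⟩
  + ∑[ c < suc r ] ballotCount (s + 2) n c
    ≡⟨ ∑-shift-combination (ballotCount (s + 2) n) (M C_) s r (λ c c≤r → ballotCount≡ s n′ c (≤-trans c≤r r≤2n)) ⟩
  + 2 ℤ.* + (M C r) - (+ s - + 2) ℤ.* + ∑[ c < r ] (M C c)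
    ≡⟨ cong (λ S → + 2 ℤ.* + (M C r) - (+ s - + 2) ℤ.* + S) (∑≡sum-upTo r (M C_)) ⟩
  + 2 ℤ.* + (M C r) - (+ s - + 2) ℤ.* + sum (map (M C_) (upTo r)) ∎
  where
  open ≡-Reasoning
  n : ℕ
  n = suc n′
  M : ℕ
  M = (s + 2) * n ∸ 1
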